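{- For integers $N\ge 1$ and $n\ge 1$, $$B_{N,n}=n!\sum_{k=1}^n\binom{n+1}{k+1}\frac{(-N!)^k\,k!}{(n+Nk)!}\begin{Bmatrix}n+Nk\\ k\end{Bmatrix}_{\ge N}.$$
   Context: The hypergeometric Bernoulli numbers $B_{N,n}$ are defined by $\frac{1}{{}_1F_1(1;N+1;x)}=\sum_{n=0}^\infty B_{N,n}\frac{x^n}{n!}$, where ${}_1F_1(a;b;z)=\sum_{n=0}^\infty\frac{(a)^{(n)}}{(b)^{(n)}}\frac{z^n}{n!}$ with $(a)^{(n)}=a(a+1)\cdots(a+n-1)$, $(a)^{(0)}=1$. For $m\ge 1$, the associated Stirling numbers of the second kind $\begin{Bmatrix}n\\ k\end{Bmatrix}_{\ge m}$ are defined by $\frac{(e^x-E_{m-1}(x))^k}{k!}=\sum_{n=0}^\infty\begin{Bmatrix}n\\ k\end{Bmatrix}_{\ge m}\frac{x^n}{n!}$, where $E_m(x)=\sum_{j=0}^m\frac{x^j}{j!}$. -}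

module Defs where

open import Data.Nat as ℕ using (ℕ; zero; suc; _!; NonZero; _∸_; _<ᵇ_)
open import Data.Nat.Properties using (m*n≢0; _!≢0)
open import Data.Nat.Combinatorics using (_C_)
open import Data.Integer as ℤ using (ℤ; +_)
open import Data.Rational using (ℚ; _/_; _+_; _*_; -_; 0ℚ; 1ℚ)
open import Data.List using (List; []; _∷_; map; foldr; upTo; zipWith; head)
open import Data.Maybe using (fromMaybe)
open import Data.Bool using (if_then_else_)

Σℚ : List ℚ → ℚ
Σℚ = foldr _+_ 0ℚ

ℕ→ℚ : ℕ → ℚ
ℕ→ℚ n = + n / 1

inv! : ℕ → ℚ
inv! n = (+ 1 / (n !)) {{n !≢0}}

rising : ℕ → ℕ → ℕ
rising a zero = 1
rising a (suc n) = a ℕ.* rising (suc a) n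

rising-nonZero : ∀ b n → NonZero (rising (suc b) n)
rising-nonZero b zero = _
rising-nonZero b (suc n) = m*n≢0 (suc b) (rising (suc (suc b)) n) {{_}} {{rising-nonZero (suc b) n}}

Series : Set
Series = ℕ → ℚ

_⊛_ : Series → Series → Series
(f ⊛ g) n = Σℚ (map (λ i → f i * g (n ∸ i)) (upTo (suc n)))

oneS : Series
oneS zero = 1ℚ
oneS (suc _) = 0ℚ

_^S_ : Series → ℕ → Series
f ^S zero = oneS
f ^S suc k = f ⊛ (f ^S k)

-- Reciprocal 1/f of a power series f with constant term f 0 = 1:
-- c 0 = 1, c n = - Σ_{j=1}^{n} f j * c (n - j)  (the unique g with f ⊛ g = 1).
-- invList f n = [c n , c (n-1) , ... , c 0]
invList : Series → ℕ → List ℚ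
invList f zero = 1ℚ ∷ []
invList f (suc n) =
  let cs = invList f n in
  (- Σℚ (zipWith (λ i c → f (suc i) * c) (upTo (suc n)) cs)) ∷ cs

recip₁ : Series → Series
recip₁ f n = fromMaybe 0ℚ (head (invList f n))

-- Coefficient sequence of 1F1(a; b; x) for natural a and b = suc b' ≥ 1:
-- coefficient of x^n is (a)^(n) / ((b)^(n) n!)
hyp1F1 : ℕ → ℕ → Series
hyp1F1 a b' n =
  (+ rising a n / (rising (suc b') n ℕ.* n !))
    {{m*n≢0 (rising (suc b') n) (n !) {{rising-nonZero b' n}} {{n !≢0}}}}

-- Hypergeometric Bernoulli numbers: 1 / 1F1(1; N+1; x) = Σ B N n x^n / n!
B : ℕ → ℕ → ℚ
B N n = ℕ→ℚ (n !) * recip₁ (hyp1F1 1 N) n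

-- e^x - E_{m-1}(x) = Σ_{j ≥ m} x^j / j!
expTail : ℕ → Series
expTail m j = if j <ᵇ m then 0ℚ else inv! j

-- associated Stirling numbers of the second kind {n k}_{≥ m}:
-- (e^x - E_{m-1}(x))^k / k! = Σ_n S≥ m n k x^n / n!
S≥ : ℕ → ℕ → ℕ → ℚ
S≥ m n k = ℕ→ℚ (n !) * (inv! k * (expTail m ^S k) n)

rhs6 : ℕ → ℕ → ℚ
rhs6 N n = ℕ→ℚ (n !) * Σℚ (map term (map suc (upTo n)))
  where
  term : ℕ → ℚ
  term k = ℕ→ℚ ((n ℕ.+ 1) C (k ℕ.+ 1))
         * ((ℤ.- (+ (N !))) ℤ.^ k / 1)
         * ℕ→ℚ (k !)
         * inv! (n ℕ.+ N ℕ.* k)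
         * S≥ N (n ℕ.+ N ℕ.* k) k

{-# OPTIONS --safe #-}
-- Write F = ₁F₁(1; N+1; x) and G = e^x − E_{N−1}(x), so that F = N! x^{−N} G.
-- Expanding 1/F = Σ_k (1 − F)^k and (1 − F)^k = Σ_j C(k,j) (−F)^j, the hockey-stick
-- identity collects the coefficient of x^n into Σ_j C(n+1, j+1) [x^n] (−F)^j, and
-- [x^n] (−F)^j = (−N!)^j [x^{n+Nj}] G^j, which is the associated Stirling number.
module Submission where

open import Defs
open import Data.Nat using (ℕ; _≥_)
open import Data.Rational using (ℚ)
open import Relation.Binary.PropositionalEquality using (_≡_)

open import Data.Bool using (true; false)
open import Data.Integer as ℤ using (+_)
import Data.Integer.Properties as ℤₚ
open import Data.List using (_∷_; map; upTo; applyUpTo; zipWith)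
open import Data.List.Properties using (map-applyUpTo)
open import Data.Nat as ℕ using (zero; suc; _<_; _≤_; _∸_; s≤s; z<s; s<s; _!; _<ᵇ_; NonZero)
import Data.Nat.Properties as ℕₚ
open import Data.Nat.Combinatorics using (_C_; nCk+nC[k+1]≡[n+1]C[k+1])
open import Data.Nat.Combinatorics.Specification using (k>n⇒nCk≡0)
open import Data.Rational using (_/_; _+_; _*_; -_; 0ℚ; 1ℚ; fromℚᵘ)
open import Data.Rational.Properties
open import Data.Rational.Solver using (module +-*-Solver)
import Data.Rational.Unnormalised as ℚᵘ
import Data.Rational.Unnormalised.Properties as ℚᵘₚ
open import Data.Unit using (tt)
open import Relation.Binary.PropositionalEquality using (refl; sym; trans; cong; cong₂; subst; subst₂; module ≡-Reasoning)
open import Relation.Nullary using (yes; no; contradiction)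

open +-*-Solver using (solve; _:+_; _:*_; _:=_)
open ≡-Reasoning

fromℚᵘ-homo-+ : ∀ p q → fromℚᵘ (p ℚᵘ.+ q) ≡ fromℚᵘ p + fromℚᵘ q
fromℚᵘ-homo-+ p q = toℚᵘ-injective (ℚᵘₚ.≃-trans (toℚᵘ-fromℚᵘ (p ℚᵘ.+ q)) (ℚᵘₚ.≃-sym
  (ℚᵘₚ.≃-trans (toℚᵘ-homo-+ (fromℚᵘ p) (fromℚᵘ q)) (ℚᵘₚ.+-cong (toℚᵘ-fromℚᵘ p) (toℚᵘ-fromℚᵘ q)))))

fromℚᵘ-homo-* : ∀ p q → fromℚᵘ (p ℚᵘ.* q) ≡ fromℚᵘ p * fromℚᵘ q
fromℚᵘ-homo-* p q = toℚᵘ-injective (ℚᵘₚ.≃-trans (toℚᵘ-fromℚᵘ (p ℚᵘ.* q)) (ℚᵘₚ.≃-sym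
  (ℚᵘₚ.≃-trans (toℚᵘ-homo-* (fromℚᵘ p) (fromℚᵘ q)) (ℚᵘₚ.*-cong (toℚᵘ-fromℚᵘ p) (toℚᵘ-fromℚᵘ q)))))

fromℚᵘ-homo‿- : ∀ p → fromℚᵘ (ℚᵘ.- p) ≡ - fromℚᵘ p
fromℚᵘ-homo‿- p = toℚᵘ-injective (ℚᵘₚ.≃-trans (toℚᵘ-fromℚᵘ (ℚᵘ.- p)) (ℚᵘₚ.≃-sym
  (ℚᵘₚ.≃-trans (toℚᵘ-homo‿- (fromℚᵘ p)) (ℚᵘₚ.-‿cong (toℚᵘ-fromℚᵘ p)))))

*≡*⇒/≡/ : ∀ a b c d .{{_ : NonZero c}} .{{_ : NonZero d}} → a ℤ.* + d ≡ b ℤ.* + c → a / c ≡ b / d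
*≡*⇒/≡/ a b (suc c) (suc d) eq = fromℚᵘ-cong {ℚᵘ.mkℚᵘ a c} {ℚᵘ.mkℚᵘ b d} (ℚᵘ.*≡* eq)

/1-homo-+ : ∀ x y → (x ℤ.+ y) / 1 ≡ x / 1 + y / 1
/1-homo-+ x y = trans (fromℚᵘ-cong {ℚᵘ.mkℚᵘ (x ℤ.+ y) 0} {ℚᵘ.mkℚᵘ x 0 ℚᵘ.+ ℚᵘ.mkℚᵘ y 0} (ℚᵘ.*≡* eq))
                      (fromℚᵘ-homo-+ (ℚᵘ.mkℚᵘ x 0) (ℚᵘ.mkℚᵘ y 0))
  where
  eq : (x ℤ.+ y) ℤ.* + 1 ≡ (x ℤ.* + 1 ℤ.+ y ℤ.* + 1) ℤ.* + 1
  eq = cong₂ (λ a b → (a ℤ.+ b) ℤ.* + 1) (sym (ℤₚ.*-identityʳ x)) (sym (ℤₚ.*-identityʳ y))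

/1-homo-* : ∀ x y → (x ℤ.* y) / 1 ≡ (x / 1) * (y / 1)
/1-homo-* x y = trans (fromℚᵘ-cong {ℚᵘ.mkℚᵘ (x ℤ.* y) 0} {ℚᵘ.mkℚᵘ x 0 ℚᵘ.* ℚᵘ.mkℚᵘ y 0} (ℚᵘ.*≡* refl))
                      (fromℚᵘ-homo-* (ℚᵘ.mkℚᵘ x 0) (ℚᵘ.mkℚᵘ y 0))

/1-homo‿- : ∀ x → (ℤ.- x) / 1 ≡ - (x / 1)
/1-homo‿- x = fromℚᵘ-homo‿- (ℚᵘ.mkℚᵘ x 0)

/1*1/≡/ : ∀ x y .{{_ : NonZero y}} → x / 1 * (+ 1 / y) ≡ x / y
/1*1/≡/ x (suc y) = trans (sym (fromℚᵘ-homo-* (ℚᵘ.mkℚᵘ x 0) (ℚᵘ.mkℚᵘ (+ 1) y)))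
  (fromℚᵘ-cong {ℚᵘ.mkℚᵘ x 0 ℚᵘ.* ℚᵘ.mkℚᵘ (+ 1) y} {ℚᵘ.mkℚᵘ x y} (ℚᵘ.*≡* (cong₂ (λ a k → a ℤ.* + suc k)
    (ℤₚ.*-identityʳ x) (sym (ℕₚ.+-identityʳ y)))))

ℕ→ℚ-homo-+ : ∀ a b → ℕ→ℚ (a ℕ.+ b) ≡ ℕ→ℚ a + ℕ→ℚ b
ℕ→ℚ-homo-+ a b = trans (cong (_/ 1) (ℤₚ.pos-+ a b)) (/1-homo-+ (+ a) (+ b))

n!*inv!n≡1 : ∀ n → ℕ→ℚ (n !) * inv! n ≡ 1ℚ
n!*inv!n≡1 n = trans (/1*1/≡/ (+ (n !)) (n !) {{n ℕₚ.!≢0}})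
  (*≡*⇒/≡/ (+ (n !)) (+ 1) (n !) 1 {{n ℕₚ.!≢0}} (trans (ℤₚ.*-identityʳ (+ (n !))) (sym (ℤₚ.*-identityˡ (+ (n !))))))

infixr 8 _^_

_^_ : ℚ → ℕ → ℚ
x ^ zero  = 1ℚ
x ^ suc k = x * x ^ k

/1-homo-^ : ∀ x k → (x ℤ.^ k) / 1 ≡ (x / 1) ^ k
/1-homo-^ x zero    = refl
/1-homo-^ x (suc k) = trans (/1-homo-* x (x ℤ.^ k)) (cong (x / 1 *_) (/1-homo-^ x k))

infix 5 ∑

∑ : ℕ → (ℕ → ℚ) → ℚ
∑ zero    h = 0ℚ
∑ (suc n) h = h 0 + ∑ n (λ i → h (suc i))

syntax ∑ n (λ i → e) = ∑[ i < n ] e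

∑-cong< : ∀ n {h g : ℕ → ℚ} → (∀ i → i < n → h i ≡ g i) → ∑ n h ≡ ∑ n g
∑-cong< zero    eq = refl
∑-cong< (suc n) eq = cong₂ _+_ (eq 0 z<s) (∑-cong< n (λ i i<n → eq (suc i) (s<s i<n)))

∑-cong : ∀ n {h g : ℕ → ℚ} → (∀ i → h i ≡ g i) → ∑ n h ≡ ∑ n g
∑-cong n eq = ∑-cong< n (λ i _ → eq i)

∑-zero : ∀ n {h : ℕ → ℚ} → (∀ i → i < n → h i ≡ 0ℚ) → ∑ n h ≡ 0ℚ
∑-zero n {h} eq = trans (∑-cong< n eq) (∑-const-0 n)
  where
  ∑-const-0 : ∀ n → ∑[ i < n ] 0ℚ ≡ 0ℚ
  ∑-const-0 zero    = refl
  ∑-const-0 (suc n) = cong (_+_ 0ℚ) (∑-const-0 n)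

∑-distrib-+ : ∀ n (h g : ℕ → ℚ) → ∑[ i < n ] (h i + g i) ≡ ∑ n h + ∑ n g
∑-distrib-+ zero    h g = refl
∑-distrib-+ (suc n) h g = trans (cong (_+_ (h 0 + g 0)) (∑-distrib-+ n (λ i → h (suc i)) (λ i → g (suc i))))
  (solve 4 (λ a b c d → (a :+ b) :+ (c :+ d) := (a :+ c) :+ (b :+ d)) refl (h 0) (g 0) _ _)

*-distribˡ-∑ : ∀ n c (h : ℕ → ℚ) → c * ∑ n h ≡ ∑[ i < n ] c * h i
*-distribˡ-∑ zero    c h = *-zeroʳ c
*-distribˡ-∑ (suc n) c h = trans (*-distribˡ-+ c (h 0) _) (cong (_+_ (c * h 0)) (*-distribˡ-∑ n c (λ i → h (suc i))))

*-distribʳ-∑ : ∀ n c (h : ℕ → ℚ) → ∑ n h * c ≡ ∑[ i < n ] h i * c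
*-distribʳ-∑ n c h = trans (*-comm (∑ n h) c) (trans (*-distribˡ-∑ n c h) (∑-cong n (λ i → *-comm c (h i))))

neg-distrib-∑ : ∀ n (h : ℕ → ℚ) → - ∑ n h ≡ ∑[ i < n ] - h i
neg-distrib-∑ zero    h = refl
neg-distrib-∑ (suc n) h = trans (neg-distrib-+ (h 0) _) (cong (_+_ (- h 0)) (neg-distrib-∑ n (λ i → h (suc i))))

∑-last : ∀ n (h : ℕ → ℚ) → ∑ (suc n) h ≡ ∑ n h + h n
∑-last zero    h = trans (+-identityʳ (h 0)) (sym (+-identityˡ (h 0)))
∑-last (suc n) h = trans (cong (_+_ (h 0)) (∑-last n (λ i → h (suc i)))) (sym (+-assoc (h 0) _ _))

∑-split : ∀ m n (h : ℕ → ℚ) → ∑ (m ℕ.+ n) h ≡ ∑ m h + (∑[ i < n ] h (m ℕ.+ i))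
∑-split zero    n h = sym (+-identityˡ _)
∑-split (suc m) n h = trans (cong (_+_ (h 0)) (∑-split m n (λ i → h (suc i)))) (sym (+-assoc (h 0) _ _))

∑-comm : ∀ m n (h : ℕ → ℕ → ℚ) → ∑[ i < m ] ∑[ j < n ] h i j ≡ ∑[ j < n ] ∑[ i < m ] h i j
∑-comm zero    n h = sym (∑-zero n (λ _ _ → refl))
∑-comm (suc m) n h = trans (cong (_+_ (∑ n (h 0))) (∑-comm m n (λ i → h (suc i))))
                           (sym (∑-distrib-+ n (h 0) (λ j → ∑[ i < m ] h (suc i) j)))

∑-vanishing-tail : ∀ {a b} (h : ℕ → ℚ) → (∀ i → a ≤ i → h i ≡ 0ℚ) → a ≤ b → ∑ b h ≡ ∑ a h
∑-vanishing-tail {a} {b} h tail a≤b = begin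
  ∑ b h                                 ≡⟨ cong (λ t → ∑ t h) (sym (ℕₚ.m+[n∸m]≡n a≤b)) ⟩
  ∑ (a ℕ.+ (b ∸ a)) h                   ≡⟨ ∑-split a (b ∸ a) h ⟩
  ∑ a h + (∑[ i < b ∸ a ] h (a ℕ.+ i)) ≡⟨ cong (_+_ (∑ a h)) (∑-zero (b ∸ a) (λ i _ → tail (a ℕ.+ i) (ℕₚ.m≤m+n a i))) ⟩
  ∑ a h + 0ℚ                            ≡⟨ +-identityʳ _ ⟩
  ∑ a h                                 ∎

Σℚ-applyUpTo : ∀ n (h : ℕ → ℚ) → Σℚ (applyUpTo h n) ≡ ∑ n h
Σℚ-applyUpTo zero    h = refl
Σℚ-applyUpTo (suc n) h = cong (_+_ (h 0)) (Σℚ-applyUpTo n (λ i → h (suc i)))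

Σℚ-map-upTo : ∀ n (h : ℕ → ℚ) → Σℚ (map h (upTo n)) ≡ ∑ n h
Σℚ-map-upTo n h = trans (cong Σℚ (map-applyUpTo (λ i → i) h n)) (Σℚ-applyUpTo n h)

C-pascal : ∀ n k → ℕ→ℚ (suc n C suc k) ≡ ℕ→ℚ (n C k) + ℕ→ℚ (n C suc k)
C-pascal n k = trans (cong ℕ→ℚ (sym (nCk+nC[k+1]≡[n+1]C[k+1] n k))) (ℕ→ℚ-homo-+ (n C k) (n C suc k))

C-vanish : ∀ {n k} → n < k → ℕ→ℚ (n C k) ≡ 0ℚ
C-vanish n<k = cong ℕ→ℚ (k>n⇒nCk≡0 n<k)

∑-pascal : ∀ k (a : ℕ → ℚ) →
  (∑[ j < suc k ] ℕ→ℚ (k C j) * a j) + (∑[ j < suc k ] ℕ→ℚ (k C j) * a (suc j))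
    ≡ ∑[ j < suc (suc k) ] ℕ→ℚ (suc k C j) * a j
∑-pascal k a = begin
  (a₀ + Lo) + Hi
    ≡⟨ cong (λ t → (a₀ + t) + Hi) (trans (sym (+-identityʳ Lo)) (cong (_+_ Lo) (sym top-vanishes))) ⟩
  (a₀ + (Lo + ℕ→ℚ (k C suc k) * a (suc k))) + Hi
    ≡⟨ cong (λ t → (a₀ + t) + Hi) (sym (∑-last k (λ j → ℕ→ℚ (k C suc j) * a (suc j)))) ⟩
  (a₀ + (∑[ j < suc k ] ℕ→ℚ (k C suc j) * a (suc j))) + Hi
    ≡⟨ solve 3 (λ x y z → (x :+ y) :+ z := x :+ (z :+ y)) refl a₀ _ Hi ⟩
  a₀ + (Hi + (∑[ j < suc k ] ℕ→ℚ (k C suc j) * a (suc j)))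
    ≡⟨ cong (_+_ a₀) (sym (∑-distrib-+ (suc k) (λ j → ℕ→ℚ (k C j) * a (suc j))
                                                (λ j → ℕ→ℚ (k C suc j) * a (suc j)))) ⟩
  a₀ + (∑[ j < suc k ] (ℕ→ℚ (k C j) * a (suc j) + ℕ→ℚ (k C suc j) * a (suc j)))
    ≡⟨ cong (_+_ a₀) (∑-cong (suc k) (λ j →
         trans (sym (*-distribʳ-+ (a (suc j)) (ℕ→ℚ (k C j)) (ℕ→ℚ (k C suc j))))
               (cong (_* a (suc j)) (sym (C-pascal k j))))) ⟩
  a₀ + (∑[ j < suc k ] ℕ→ℚ (suc k C suc j) * a (suc j)) ∎
  where
  a₀ = ℕ→ℚ (k C 0) * a 0
  Lo = ∑[ j < k ] ℕ→ℚ (k C suc j) * a (suc j)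
  Hi = ∑[ j < suc k ] ℕ→ℚ (k C j) * a (suc j)
  top-vanishes : ℕ→ℚ (k C suc k) * a (suc k) ≡ 0ℚ
  top-vanishes = trans (cong (_* a (suc k)) (C-vanish (ℕₚ.n<1+n k))) (*-zeroˡ (a (suc k)))

hockey-stick : ∀ n j → ∑[ k < suc n ] ℕ→ℚ (k C j) ≡ ℕ→ℚ (suc n C suc j)
hockey-stick zero    j = sym (trans (C-pascal 0 j) (cong (_+_ (ℕ→ℚ (0 C j))) (C-vanish {0} {suc j} z<s)))
hockey-stick (suc n) j = begin
  ∑[ k < suc (suc n) ] ℕ→ℚ (k C j)             ≡⟨ ∑-last (suc n) (λ k → ℕ→ℚ (k C j)) ⟩
  (∑[ k < suc n ] ℕ→ℚ (k C j)) + ℕ→ℚ (suc n C j) ≡⟨ cong (_+ ℕ→ℚ (suc n C j)) (hockey-stick n j) ⟩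
  ℕ→ℚ (suc n C suc j) + ℕ→ℚ (suc n C j)         ≡⟨ +-comm (ℕ→ℚ (suc n C suc j)) (ℕ→ℚ (suc n C j)) ⟩
  ℕ→ℚ (suc n C j) + ℕ→ℚ (suc n C suc j)         ≡⟨ sym (C-pascal (suc n) j) ⟩
  ℕ→ℚ (suc (suc n) C suc j)                     ∎

∑-hockey-stick : ∀ n (a : ℕ → ℚ) →
  ∑[ k < suc n ] ∑[ j < suc k ] ℕ→ℚ (k C j) * a j ≡ ∑[ j < suc n ] ℕ→ℚ (suc n C suc j) * a j
∑-hockey-stick n a = begin
  ∑[ k < suc n ] ∑[ j < suc k ] ℕ→ℚ (k C j) * a j
    ≡⟨ ∑-cong< (suc n) (λ k k<1+n → sym (∑-vanishing-tail (λ j → ℕ→ℚ (k C j) * a j)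
         (λ j k<j → trans (cong (_* a j) (C-vanish k<j)) (*-zeroˡ (a j))) k<1+n)) ⟩
  ∑[ k < suc n ] ∑[ j < suc n ] ℕ→ℚ (k C j) * a j
    ≡⟨ ∑-comm (suc n) (suc n) (λ k j → ℕ→ℚ (k C j) * a j) ⟩
  ∑[ j < suc n ] ∑[ k < suc n ] ℕ→ℚ (k C j) * a j
    ≡⟨ ∑-cong (suc n) (λ j → trans (sym (*-distribʳ-∑ (suc n) (a j) (λ k → ℕ→ℚ (k C j))))
                                   (cong (_* a j) (hockey-stick n j))) ⟩
  ∑[ j < suc n ] ℕ→ℚ (suc n C suc j) * a j ∎

-- Formal power series

⊛-coeff : ∀ (f g : Series) n → (f ⊛ g) n ≡ ∑[ i < suc n ] f i * g (n ∸ i)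
⊛-coeff f g n = Σℚ-map-upTo (suc n) (λ i → f i * g (n ∸ i))

⊛-coeff-suc : ∀ (f g : Series) → f 0 ≡ 0ℚ → ∀ n → (f ⊛ g) (suc n) ≡ ∑[ i < suc n ] f (suc i) * g (n ∸ i)
⊛-coeff-suc f g f₀ n = trans (⊛-coeff f g (suc n))
  (trans (cong (_+ (∑[ i < suc n ] f (suc i) * g (n ∸ i))) (trans (cong (_* g (suc n)) f₀) (*-zeroˡ (g (suc n)))))
         (+-identityˡ _))

⊛-congʳ : ∀ (f : Series) {X Y : Series} → (∀ t → X t ≡ Y t) → ∀ m → (f ⊛ X) m ≡ (f ⊛ Y) m
⊛-congʳ f {X} {Y} eq m =
  trans (⊛-coeff f X m) (trans (∑-cong (suc m) (λ i → cong (f i *_) (eq (m ∸ i)))) (sym (⊛-coeff f Y m)))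

⊛-*ʳ : ∀ (f X : Series) c m → (f ⊛ (λ t → c * X t)) m ≡ c * (f ⊛ X) m
⊛-*ʳ f X c m = begin
  (f ⊛ (λ t → c * X t)) m
    ≡⟨ ⊛-coeff f (λ t → c * X t) m ⟩
  ∑[ i < suc m ] f i * (c * X (m ∸ i))
    ≡⟨ ∑-cong (suc m) (λ i → solve 3 (λ a b x → a :* (b :* x) := b :* (a :* x)) refl (f i) c (X (m ∸ i))) ⟩
  ∑[ i < suc m ] c * (f i * X (m ∸ i))
    ≡⟨ sym (*-distribˡ-∑ (suc m) c (λ i → f i * X (m ∸ i))) ⟩
  c * (∑[ i < suc m ] f i * X (m ∸ i))
    ≡⟨ cong (c *_) (sym (⊛-coeff f X m)) ⟩
  c * (f ⊛ X) m ∎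

⊛-∑ʳ : ∀ (f : Series) K (Y : ℕ → Series) m → (f ⊛ (λ t → ∑[ j < K ] Y j t)) m ≡ ∑[ j < K ] (f ⊛ Y j) m
⊛-∑ʳ f K Y m = begin
  (f ⊛ (λ t → ∑[ j < K ] Y j t)) m
    ≡⟨ ⊛-coeff f (λ t → ∑[ j < K ] Y j t) m ⟩
  ∑[ i < suc m ] f i * (∑[ j < K ] Y j (m ∸ i))
    ≡⟨ ∑-cong (suc m) (λ i → *-distribˡ-∑ K (f i) (λ j → Y j (m ∸ i))) ⟩
  ∑[ i < suc m ] ∑[ j < K ] f i * Y j (m ∸ i)
    ≡⟨ ∑-comm (suc m) K (λ i j → f i * Y j (m ∸ i)) ⟩
  ∑[ j < K ] ∑[ i < suc m ] f i * Y j (m ∸ i)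
    ≡⟨ ∑-cong K (λ j → sym (⊛-coeff f (Y j) m)) ⟩
  ∑[ j < K ] (f ⊛ Y j) m ∎

oneS-⊛ : ∀ (X : Series) m → (oneS ⊛ X) m ≡ X m
oneS-⊛ X m = begin
  (oneS ⊛ X) m
    ≡⟨ ⊛-coeff oneS X m ⟩
  1ℚ * X m + (∑[ i < m ] 0ℚ * X (m ∸ suc i))
    ≡⟨ cong₂ _+_ (*-identityˡ (X m)) (∑-zero m (λ i _ → *-zeroˡ (X (m ∸ suc i)))) ⟩
  X m + 0ℚ
    ≡⟨ +-identityʳ (X m) ⟩
  X m ∎

⊛-distribʳ-+ : ∀ {w f g : Series} → (∀ i → w i ≡ f i + g i) → ∀ X m → (w ⊛ X) m ≡ (f ⊛ X) m + (g ⊛ X) m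
⊛-distribʳ-+ {w} {f} {g} w≡f+g X m = begin
  (w ⊛ X) m
    ≡⟨ ⊛-coeff w X m ⟩
  ∑[ i < suc m ] w i * X (m ∸ i)
    ≡⟨ ∑-cong (suc m) (λ i → trans (cong (_* X (m ∸ i)) (w≡f+g i)) (*-distribʳ-+ (X (m ∸ i)) (f i) (g i))) ⟩
  ∑[ i < suc m ] (f i * X (m ∸ i) + g i * X (m ∸ i))
    ≡⟨ ∑-distrib-+ (suc m) (λ i → f i * X (m ∸ i)) (λ i → g i * X (m ∸ i)) ⟩
  (∑[ i < suc m ] f i * X (m ∸ i)) + (∑[ i < suc m ] g i * X (m ∸ i))
    ≡⟨ sym (cong₂ _+_ (⊛-coeff f X m) (⊛-coeff g X m)) ⟩
  (f ⊛ X) m + (g ⊛ X) m ∎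

^S-vanish : ∀ {N} {g : Series} → (∀ i → i < N → g i ≡ 0ℚ) → ∀ k m → m < N ℕ.* k → (g ^S k) m ≡ 0ℚ
^S-vanish {N} g₀ zero m m<N*0 = contradiction (subst (m <_) (ℕₚ.*-zeroʳ N) m<N*0) λ ()
^S-vanish {N} {g} g₀ (suc k) m m<N*[1+k] = trans (⊛-coeff g (g ^S k) m) (∑-zero (suc m) term-vanishes)
  where
  term-vanishes : ∀ i → i < suc m → g i * (g ^S k) (m ∸ i) ≡ 0ℚ
  term-vanishes i i<1+m with i ℕₚ.<? N
  ... | yes i<N = trans (cong (_* (g ^S k) (m ∸ i)) (g₀ i i<N)) (*-zeroˡ ((g ^S k) (m ∸ i)))
  ... | no  i≮N = trans (cong (g i *_) (^S-vanish g₀ k (m ∸ i) m∸i<N*k)) (*-zeroʳ (g i))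
    where
    N≤m : N ℕ.≤ m
    N≤m = ℕₚ.≤-trans (ℕₚ.≮⇒≥ i≮N) (ℕₚ.≤-pred i<1+m)
    m∸N<N*k : m ∸ N < N ℕ.* k
    m∸N<N*k = ℕₚ.+-cancelˡ-< N (m ∸ N) (N ℕ.* k)
      (subst₂ _<_ (sym (ℕₚ.m+[n∸m]≡n N≤m)) (ℕₚ.*-suc N k) m<N*[1+k])
    m∸i<N*k : m ∸ i < N ℕ.* k
    m∸i<N*k = ℕₚ.≤-<-trans (ℕₚ.∸-monoʳ-≤ m (ℕₚ.≮⇒≥ i≮N)) m∸N<N*k

⊛-*ˡ : ∀ {f F : Series} {c} → (∀ i → f i ≡ c * F i) → ∀ X m → (f ⊛ X) m ≡ c * (F ⊛ X) m
⊛-*ˡ {f} {F} {c} f≡cF X m = begin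
  (f ⊛ X) m
    ≡⟨ ⊛-coeff f X m ⟩
  ∑[ i < suc m ] f i * X (m ∸ i)
    ≡⟨ ∑-cong (suc m) (λ i → trans (cong (_* X (m ∸ i)) (f≡cF i)) (*-assoc c (F i) (X (m ∸ i)))) ⟩
  ∑[ i < suc m ] c * (F i * X (m ∸ i))
    ≡⟨ sym (*-distribˡ-∑ (suc m) c (λ i → F i * X (m ∸ i))) ⟩
  c * (∑[ i < suc m ] F i * X (m ∸ i))
    ≡⟨ cong (c *_) (sym (⊛-coeff F X m)) ⟩
  c * (F ⊛ X) m ∎

⊛-shift : ∀ {N Q} (g G : Series) → (∀ i → i < N → g i ≡ 0ℚ) → (∀ t → t < Q → G t ≡ 0ℚ) →
  ∀ n → (g ⊛ G) (n ℕ.+ (N ℕ.+ Q)) ≡ ((λ i → g (i ℕ.+ N)) ⊛ (λ t → G (t ℕ.+ Q))) n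
⊛-shift {N} {Q} g G g₀ G₀ n = begin
  (g ⊛ G) M
    ≡⟨ ⊛-coeff g G M ⟩
  ∑ (suc M) h
    ≡⟨ cong (λ t → ∑ t h) 1+M≡N+[1+n+Q] ⟩
  ∑ (N ℕ.+ (suc n ℕ.+ Q)) h
    ≡⟨ ∑-split N (suc n ℕ.+ Q) h ⟩
  ∑ N h + (∑[ i < suc n ℕ.+ Q ] h (N ℕ.+ i))
    ≡⟨ cong₂ _+_ (∑-zero N (λ i i<N → trans (cong (_* G (M ∸ i)) (g₀ i i<N)) (*-zeroˡ (G (M ∸ i)))))
                 (∑-split (suc n) Q (λ i → h (N ℕ.+ i))) ⟩
  0ℚ + ((∑[ i < suc n ] h (N ℕ.+ i)) + (∑[ i < Q ] h (N ℕ.+ (suc n ℕ.+ i))))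
    ≡⟨ cong (λ t → 0ℚ + ((∑[ i < suc n ] h (N ℕ.+ i)) + t)) (∑-zero Q (λ i i<Q →
         trans (cong (g (N ℕ.+ (suc n ℕ.+ i)) *_) (G₀ _ (beyond i<Q))) (*-zeroʳ (g (N ℕ.+ (suc n ℕ.+ i)))))) ⟩
  0ℚ + ((∑[ i < suc n ] h (N ℕ.+ i)) + 0ℚ)
    ≡⟨ trans (+-identityˡ _) (+-identityʳ _) ⟩
  ∑[ i < suc n ] h (N ℕ.+ i)
    ≡⟨ ∑-cong< (suc n) (λ i i<1+n → cong₂ (λ a b → g a * G b) (ℕₚ.+-comm N i) (within (ℕₚ.≤-pred i<1+n))) ⟩
  ∑[ i < suc n ] g (i ℕ.+ N) * G ((n ∸ i) ℕ.+ Q)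
    ≡⟨ sym (⊛-coeff (λ i → g (i ℕ.+ N)) (λ t → G (t ℕ.+ Q)) n) ⟩
  ((λ i → g (i ℕ.+ N)) ⊛ (λ t → G (t ℕ.+ Q))) n ∎
  where
  M = n ℕ.+ (N ℕ.+ Q)
  h : ℕ → ℚ
  h i = g i * G (M ∸ i)
  M≡N+[n+Q] : M ≡ N ℕ.+ (n ℕ.+ Q)
  M≡N+[n+Q] = trans (sym (ℕₚ.+-assoc n N Q)) (trans (cong (ℕ._+ Q) (ℕₚ.+-comm n N)) (ℕₚ.+-assoc N n Q))
  1+M≡N+[1+n+Q] : suc M ≡ N ℕ.+ (suc n ℕ.+ Q)
  1+M≡N+[1+n+Q] = trans (cong suc M≡N+[n+Q]) (sym (ℕₚ.+-suc N (n ℕ.+ Q)))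
  M∸[N+i]≡n+Q∸i : ∀ i → M ∸ (N ℕ.+ i) ≡ (n ℕ.+ Q) ∸ i
  M∸[N+i]≡n+Q∸i i = trans (cong (_∸ (N ℕ.+ i)) M≡N+[n+Q]) (ℕₚ.[m+n]∸[m+o]≡n∸o N (n ℕ.+ Q) i)
  within : ∀ {i} → i ≤ n → M ∸ (N ℕ.+ i) ≡ (n ∸ i) ℕ.+ Q
  within {i} i≤n = trans (M∸[N+i]≡n+Q∸i i) (ℕₚ.+-∸-comm Q i≤n)
  beyond : ∀ {i} → i < Q → M ∸ (N ℕ.+ (suc n ℕ.+ i)) < Q
  beyond {i} i<Q = subst (_< Q) (sym M∸[N+1+n+i]≡Q∸[1+i]) (ℕₚ.∸-monoʳ-< {Q} {suc i} {0} z<s i<Q)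
    where
    M∸[N+1+n+i]≡Q∸[1+i] : M ∸ (N ℕ.+ (suc n ℕ.+ i)) ≡ Q ∸ suc i
    M∸[N+1+n+i]≡Q∸[1+i] = trans (M∸[N+i]≡n+Q∸i (suc n ℕ.+ i))
      (trans (cong ((n ℕ.+ Q) ∸_) (sym (ℕₚ.+-suc n i))) (ℕₚ.[m+n]∸[m+o]≡n∸o n Q (suc i)))

^S-shift : ∀ {N c} {f g : Series} → (∀ i → i < N → g i ≡ 0ℚ) → (∀ i → f i ≡ c * g (i ℕ.+ N)) →
  ∀ k n → (f ^S k) n ≡ c ^ k * (g ^S k) (n ℕ.+ N ℕ.* k)
^S-shift {N} g₀ f≡cg zero n = begin
  oneS n                        ≡⟨ cong oneS (sym (trans (cong (n ℕ.+_) (ℕₚ.*-zeroʳ N)) (ℕₚ.+-identityʳ n))) ⟩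
  oneS (n ℕ.+ N ℕ.* 0)          ≡⟨ sym (*-identityˡ _) ⟩
  1ℚ * oneS (n ℕ.+ N ℕ.* 0)     ∎
^S-shift {N} {c} {f} {g} g₀ f≡cg (suc k) n = begin
  (f ⊛ (f ^S k)) n
    ≡⟨ ⊛-congʳ f (^S-shift g₀ f≡cg k) n ⟩
  (f ⊛ (λ t → c ^ k * Gₖ t)) n
    ≡⟨ ⊛-*ʳ f Gₖ (c ^ k) n ⟩
  c ^ k * (f ⊛ Gₖ) n
    ≡⟨ cong (c ^ k *_) (⊛-*ˡ {f} {λ i → g (i ℕ.+ N)} {c} f≡cg Gₖ n) ⟩
  c ^ k * (c * ((λ i → g (i ℕ.+ N)) ⊛ Gₖ) n)
    ≡⟨ cong (λ x → c ^ k * (c * x)) (sym (⊛-shift g (g ^S k) g₀ (^S-vanish g₀ k) n)) ⟩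
  c ^ k * (c * (g ^S suc k) (n ℕ.+ (N ℕ.+ N ℕ.* k)))
    ≡⟨ solve 3 (λ a b x → a :* (b :* x) := (b :* a) :* x) refl (c ^ k) c _ ⟩
  c ^ suc k * (g ^S suc k) (n ℕ.+ (N ℕ.+ N ℕ.* k))
    ≡⟨ cong (λ m → c ^ suc k * (g ^S suc k) (n ℕ.+ m)) (sym (ℕₚ.*-suc N k)) ⟩
  c ^ suc k * (g ^S suc k) (n ℕ.+ N ℕ.* suc k) ∎
  where
  Gₖ : Series
  Gₖ t = (g ^S k) (t ℕ.+ N ℕ.* k)

binomial : ∀ {w h : Series} → (∀ i → w i ≡ oneS i + h i) →
  ∀ k m → (w ^S k) m ≡ ∑[ j < suc k ] ℕ→ℚ (k C j) * (h ^S j) m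
binomial w≡1+h zero m = sym (trans (+-identityʳ _) (*-identityˡ (oneS m)))
binomial {w} {h} w≡1+h (suc k) m = begin
  (w ⊛ (w ^S k)) m
    ≡⟨ ⊛-distribʳ-+ {w} {oneS} {h} w≡1+h (w ^S k) m ⟩
  (oneS ⊛ (w ^S k)) m + (h ⊛ (w ^S k)) m
    ≡⟨ cong₂ _+_ (trans (oneS-⊛ (w ^S k) m) (binomial w≡1+h k m)) (⊛-congʳ h (binomial w≡1+h k) m) ⟩
  (∑[ j < suc k ] ℕ→ℚ (k C j) * (h ^S j) m) + (h ⊛ (λ t → ∑[ j < suc k ] ℕ→ℚ (k C j) * (h ^S j) t)) m
    ≡⟨ cong (_+_ (∑[ j < suc k ] ℕ→ℚ (k C j) * (h ^S j) m))
         (trans (⊛-∑ʳ h (suc k) (λ j t → ℕ→ℚ (k C j) * (h ^S j) t) m)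
                (∑-cong (suc k) (λ j → ⊛-*ʳ h (h ^S j) (ℕ→ℚ (k C j)) m))) ⟩
  (∑[ j < suc k ] ℕ→ℚ (k C j) * (h ^S j) m) + (∑[ j < suc k ] ℕ→ℚ (k C j) * (h ^S suc j) m)
    ≡⟨ ∑-pascal k (λ j → (h ^S j) m) ⟩
  ∑[ j < suc (suc k) ] ℕ→ℚ (suc k C j) * (h ^S j) m ∎

-- Reciprocals as geometric series

zipWith-applyUpTo : ∀ {A B C : Set} (_∙_ : A → B → C) (a : ℕ → A) (b : ℕ → B) n →
  zipWith _∙_ (applyUpTo a n) (applyUpTo b n) ≡ applyUpTo (λ i → a i ∙ b i) n
zipWith-applyUpTo _∙_ a b zero    = refl
zipWith-applyUpTo _∙_ a b (suc n) = cong (a 0 ∙ b 0 ∷_) (zipWith-applyUpTo _∙_ (λ i → a (suc i)) (λ i → b (suc i)) n)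

invList-applyUpTo : ∀ f n → invList f n ≡ applyUpTo (λ i → recip₁ f (n ∸ i)) (suc n)
invList-applyUpTo f zero    = refl
invList-applyUpTo f (suc n) = cong (recip₁ f (suc n) ∷_) (invList-applyUpTo f n)

-- The recursion defining recip₁ never reads f 0, so recip₁ expands in powers of oneMinus f,
-- which agrees with 1 − f exactly when f 0 = 1.
oneMinus : Series → Series
oneMinus f zero    = 0ℚ
oneMinus f (suc i) = - f (suc i)

recip₁-suc : ∀ f n → recip₁ f (suc n) ≡ ∑[ i < suc n ] oneMinus f (suc i) * recip₁ f (n ∸ i)
recip₁-suc f n = begin
  - Σℚ (zipWith _∙_ (upTo (suc n)) (invList f n))
    ≡⟨ cong (λ cs → - Σℚ (zipWith _∙_ (upTo (suc n)) cs)) (invList-applyUpTo f n) ⟩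
  - Σℚ (zipWith _∙_ (upTo (suc n)) (applyUpTo (λ i → recip₁ f (n ∸ i)) (suc n)))
    ≡⟨ cong (λ xs → - Σℚ xs) (zipWith-applyUpTo _∙_ (λ i → i) (λ i → recip₁ f (n ∸ i)) (suc n)) ⟩
  - Σℚ (applyUpTo (λ i → f (suc i) * recip₁ f (n ∸ i)) (suc n))
    ≡⟨ cong -_ (Σℚ-applyUpTo (suc n) (λ i → f (suc i) * recip₁ f (n ∸ i))) ⟩
  - (∑[ i < suc n ] f (suc i) * recip₁ f (n ∸ i))
    ≡⟨ neg-distrib-∑ (suc n) (λ i → f (suc i) * recip₁ f (n ∸ i)) ⟩
  ∑[ i < suc n ] - (f (suc i) * recip₁ f (n ∸ i))
    ≡⟨ ∑-cong (suc n) (λ i → neg-distribˡ-* (f (suc i)) (recip₁ f (n ∸ i))) ⟩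
  ∑[ i < suc n ] oneMinus f (suc i) * recip₁ f (n ∸ i) ∎
  where
  _∙_ : ℕ → ℚ → ℚ
  i ∙ c = f (suc i) * c

recurrence-unique : ∀ (c a b : Series) → a 0 ≡ b 0 →
  (∀ n → a (suc n) ≡ ∑[ i < suc n ] c (suc i) * a (n ∸ i)) →
  (∀ n → b (suc n) ≡ ∑[ i < suc n ] c (suc i) * b (n ∸ i)) →
  ∀ n → a n ≡ b n
recurrence-unique c a b a₀≡b₀ rec-a rec-b n = agree n n ℕₚ.≤-refl
  where
  agree : ∀ bound m → m ≤ bound → a m ≡ b m
  agree _           zero    _           = a₀≡b₀
  agree (suc bound) (suc m) (s≤s m≤bound) = trans (rec-a m) (trans
    (∑-cong (suc m) (λ i → cong (c (suc i) *_) (agree bound (m ∸ i) (ℕₚ.≤-trans (ℕₚ.m∸n≤m m i) m≤bound))))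
    (sym (rec-b m)))

geometric : Series → Series
geometric v n = ∑[ k < suc n ] (v ^S k) n

geometric-extend : ∀ (v : Series) → v 0 ≡ 0ℚ → ∀ {K} n → n < K → ∑[ k < K ] (v ^S k) n ≡ geometric v n
geometric-extend v v₀ n n<K = ∑-vanishing-tail (λ k → (v ^S k) n)
  (λ k n<k → ^S-vanish {1} order≥1 k n (subst (n <_) (sym (ℕₚ.*-identityˡ k)) n<k)) n<K
  where
  order≥1 : ∀ i → i < 1 → v i ≡ 0ℚ
  order≥1 zero    _         = v₀
  order≥1 (suc i) (s<s ())

geometric-suc : ∀ (v : Series) → v 0 ≡ 0ℚ → ∀ n →
  geometric v (suc n) ≡ ∑[ i < suc n ] v (suc i) * geometric v (n ∸ i)
geometric-suc v v₀ n = begin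
  0ℚ + (∑[ k < suc n ] (v ⊛ (v ^S k)) (suc n))
    ≡⟨ +-identityˡ _ ⟩
  ∑[ k < suc n ] (v ⊛ (v ^S k)) (suc n)
    ≡⟨ ∑-cong (suc n) (λ k → ⊛-coeff-suc v (v ^S k) v₀ n) ⟩
  ∑[ k < suc n ] ∑[ i < suc n ] v (suc i) * (v ^S k) (n ∸ i)
    ≡⟨ ∑-comm (suc n) (suc n) (λ k i → v (suc i) * (v ^S k) (n ∸ i)) ⟩
  ∑[ i < suc n ] ∑[ k < suc n ] v (suc i) * (v ^S k) (n ∸ i)
    ≡⟨ ∑-cong (suc n) (λ i → sym (*-distribˡ-∑ (suc n) (v (suc i)) (λ k → (v ^S k) (n ∸ i)))) ⟩
  ∑[ i < suc n ] v (suc i) * (∑[ k < suc n ] (v ^S k) (n ∸ i))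
    ≡⟨ ∑-cong (suc n) (λ i → cong (v (suc i) *_) (geometric-extend v v₀ (n ∸ i) (s≤s (ℕₚ.m∸n≤m n i)))) ⟩
  ∑[ i < suc n ] v (suc i) * geometric v (n ∸ i) ∎

recip₁-geometric : ∀ f n → recip₁ f n ≡ geometric (oneMinus f) n
recip₁-geometric f = recurrence-unique (oneMinus f) (recip₁ f) (geometric (oneMinus f))
  refl (recip₁-suc f) (geometric-suc (oneMinus f) refl)

negateˢ : Series → Series
negateˢ f i = - f i

oneMinus-≡-1+negateˢ : ∀ {f} → f 0 ≡ 1ℚ → ∀ i → oneMinus f i ≡ oneS i + negateˢ f i
oneMinus-≡-1+negateˢ f₀ zero    = trans (sym (+-inverseʳ 1ℚ)) (cong (λ x → 1ℚ + - x) (sym f₀))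
oneMinus-≡-1+negateˢ f₀ (suc i) = sym (+-identityˡ _)

recip₁-binomial : ∀ {f} → f 0 ≡ 1ℚ → ∀ n →
  recip₁ f n ≡ ∑[ j < suc n ] ℕ→ℚ (suc n C suc j) * (negateˢ f ^S j) n
recip₁-binomial {f} f₀ n = begin
  recip₁ f n
    ≡⟨ recip₁-geometric f n ⟩
  ∑[ k < suc n ] (oneMinus f ^S k) n
    ≡⟨ ∑-cong (suc n) (λ k → binomial {oneMinus f} {negateˢ f} (oneMinus-≡-1+negateˢ {f} f₀) k n) ⟩
  ∑[ k < suc n ] ∑[ j < suc k ] ℕ→ℚ (k C j) * (negateˢ f ^S j) n
    ≡⟨ ∑-hockey-stick n (λ j → (negateˢ f ^S j) n) ⟩
  ∑[ j < suc n ] ℕ→ℚ (suc n C suc j) * (negateˢ f ^S j) n ∎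

-- The hypergeometric series as a shifted exponential tail

rising-! : ∀ a j → a ! ℕ.* rising (suc a) j ≡ (a ℕ.+ j) !
rising-! a zero    = trans (ℕₚ.*-identityʳ (a !)) (cong _! (sym (ℕₚ.+-identityʳ a)))
rising-! a (suc j) = begin
  a ! ℕ.* (suc a ℕ.* rising (suc (suc a)) j) ≡⟨ sym (ℕₚ.*-assoc (a !) (suc a) _) ⟩
  a ! ℕ.* suc a ℕ.* rising (suc (suc a)) j   ≡⟨ cong (ℕ._* rising (suc (suc a)) j) (ℕₚ.*-comm (a !) (suc a)) ⟩
  suc a ! ℕ.* rising (suc (suc a)) j         ≡⟨ rising-! (suc a) j ⟩
  (suc a ℕ.+ j) !                            ≡⟨ cong _! (sym (ℕₚ.+-suc a j)) ⟩
  (a ℕ.+ suc j) !                            ∎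

expTail-below : ∀ {N} m → m < N → expTail N m ≡ 0ℚ
expTail-below {N} m m<N with m <ᵇ N | ℕₚ.<⇒<ᵇ m<N
... | true  | _  = refl
... | false | ()

expTail-shifted : ∀ N j → expTail N (j ℕ.+ N) ≡ inv! (j ℕ.+ N)
expTail-shifted N j with (j ℕ.+ N) <ᵇ N | ℕₚ.<ᵇ⇒< (j ℕ.+ N) N
... | false | _          = refl
... | true  | j+N<N-of-T = contradiction (j+N<N-of-T tt) (ℕₚ.≤⇒≯ (ℕₚ.m≤n+m N j))

hyp1F1-1 : ∀ N j → hyp1F1 1 N j ≡ ℕ→ℚ (N !) * expTail N (j ℕ.+ N)
hyp1F1-1 N j = trans
  (*≡*⇒/≡/ (+ rising 1 j) (+ (N !)) (R ℕ.* j !) ((j ℕ.+ N) !)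
    {{ℕₚ.m*n≢0 R (j !) {{rising-nonZero N j}} {{j ℕₚ.!≢0}}}} {{(j ℕ.+ N) ℕₚ.!≢0}} cross)
  (sym (trans (cong (ℕ→ℚ (N !) *_) (expTail-shifted N j)) (/1*1/≡/ (+ (N !)) ((j ℕ.+ N) !) {{(j ℕ.+ N) ℕₚ.!≢0}})))
  where
  R = rising (suc N) j
  cross-ℕ : rising 1 j ℕ.* (j ℕ.+ N) ! ≡ N ! ℕ.* (R ℕ.* j !)
  cross-ℕ = begin
    rising 1 j ℕ.* (j ℕ.+ N) !    ≡⟨ cong (ℕ._* (j ℕ.+ N) !) (trans (sym (ℕₚ.+-identityʳ _)) (rising-! 0 j)) ⟩
    j ! ℕ.* (j ℕ.+ N) !           ≡⟨ cong (λ m → j ! ℕ.* m !) (ℕₚ.+-comm j N) ⟩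
    j ! ℕ.* (N ℕ.+ j) !           ≡⟨ cong (j ! ℕ.*_) (sym (rising-! N j)) ⟩
    j ! ℕ.* (N ! ℕ.* R)           ≡⟨ ℕₚ.*-comm (j !) (N ! ℕ.* R) ⟩
    N ! ℕ.* R ℕ.* j !             ≡⟨ ℕₚ.*-assoc (N !) R (j !) ⟩
    N ! ℕ.* (R ℕ.* j !)           ∎
  cross : + rising 1 j ℤ.* + ((j ℕ.+ N) !) ≡ + (N !) ℤ.* + (R ℕ.* j !)
  cross = trans (sym (ℤₚ.pos-* (rising 1 j) _)) (trans (cong +_ cross-ℕ) (ℤₚ.pos-* (N !) _))

negateˢ-hyp1F1-1 : ∀ N j → negateˢ (hyp1F1 1 N) j ≡ - ℕ→ℚ (N !) * expTail N (j ℕ.+ N)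
negateˢ-hyp1F1-1 N j = trans (cong -_ (hyp1F1-1 N j)) (neg-distribˡ-* (ℕ→ℚ (N !)) _)

Σℚ-map-suc-upTo : ∀ n (t : ℕ → ℚ) → Σℚ (map t (map suc (upTo n))) ≡ ∑[ j < n ] t (suc j)
Σℚ-map-suc-upTo n t = begin
  Σℚ (map t (map suc (upTo n)))        ≡⟨ cong (λ xs → Σℚ (map t xs)) (map-applyUpTo (λ i → i) suc n) ⟩
  Σℚ (map t (applyUpTo suc n))         ≡⟨ cong Σℚ (map-applyUpTo suc t n) ⟩
  Σℚ (applyUpTo (λ j → t (suc j)) n)   ≡⟨ Σℚ-applyUpTo n (λ j → t (suc j)) ⟩
  ∑[ j < n ] t (suc j)                 ∎

rhs6-term : ∀ n k m a X →
  ℕ→ℚ ((n ℕ.+ 1) C (k ℕ.+ 1)) * ((ℤ.- (+ a)) ℤ.^ k / 1) * ℕ→ℚ (k !) * inv! m * (ℕ→ℚ (m !) * (inv! k * X))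
    ≡ ℕ→ℚ (suc n C suc k) * ((- ℕ→ℚ a) ^ k * X)
rhs6-term n k m a X = begin
  ℕ→ℚ ((n ℕ.+ 1) C (k ℕ.+ 1)) * ((ℤ.- (+ a)) ℤ.^ k / 1) * k! * 1/m! * (m! * (1/k! * X))
    ≡⟨ cong₂ (λ b p → b * p * k! * 1/m! * (m! * (1/k! * X))) binomial-shape power-shape ⟩
  b * p * k! * 1/m! * (m! * (1/k! * X))
    ≡⟨ solve 7 (λ b p x y z w X' → b :* p :* x :* y :* (z :* (w :* X')) := (b :* (p :* X')) :* ((x :* w) :* (z :* y)))
               refl b p k! 1/m! m! 1/k! X ⟩
  b * (p * X) * ((k! * 1/k!) * (m! * 1/m!))
    ≡⟨ cong (λ u → b * (p * X) * u) (trans (cong₂ _*_ (n!*inv!n≡1 k) (n!*inv!n≡1 m)) (*-identityˡ 1ℚ)) ⟩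
  b * (p * X) * 1ℚ
    ≡⟨ *-identityʳ _ ⟩
  b * (p * X) ∎
  where
  b = ℕ→ℚ (suc n C suc k)
  p = (- ℕ→ℚ a) ^ k
  k! = ℕ→ℚ (k !)
  m! = ℕ→ℚ (m !)
  1/k! = inv! k
  1/m! = inv! m
  binomial-shape : ℕ→ℚ ((n ℕ.+ 1) C (k ℕ.+ 1)) ≡ b
  binomial-shape = cong₂ (λ x y → ℕ→ℚ (x C y)) (ℕₚ.+-comm n 1) (ℕₚ.+-comm k 1)
  power-shape : (ℤ.- (+ a)) ℤ.^ k / 1 ≡ p
  power-shape = trans (/1-homo-^ (ℤ.- (+ a)) k) (cong (_^ k) (/1-homo‿- (+ a)))

rhs6-∑ : ∀ N n → rhs6 N n ≡ ℕ→ℚ (n !) *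
  (∑[ j < n ] ℕ→ℚ (suc n C suc (suc j)) * ((- ℕ→ℚ (N !)) ^ suc j * (expTail N ^S suc j) (n ℕ.+ N ℕ.* suc j)))
rhs6-∑ N n = cong (ℕ→ℚ (n !) *_) (trans (Σℚ-map-suc-upTo n _) (∑-cong n (λ j →
  rhs6-term n (suc j) (n ℕ.+ N ℕ.* suc j) (N !) ((expTail N ^S suc j) (n ℕ.+ N ℕ.* suc j)))))

theorem6 : (N n : ℕ) → N ≥ 1 → n ≥ 1 → B N n ≡ rhs6 N n
theorem6 N (suc n) _ _ = trans (cong (ℕ→ℚ (suc n !) *_) expansion) (sym (rhs6-∑ N (suc n)))
  where
  F = hyp1F1 1 N
  c : ℕ → ℚ
  c j = ℕ→ℚ (suc (suc n) C suc (suc j))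
  expansion : recip₁ F (suc n) ≡
    ∑[ j < suc n ] c j * ((- ℕ→ℚ (N !)) ^ suc j * (expTail N ^S suc j) (suc n ℕ.+ N ℕ.* suc j))
  expansion = begin
    recip₁ F (suc n)
      ≡⟨ recip₁-binomial {F} refl (suc n) ⟩
    ℕ→ℚ (suc (suc n) C 1) * 0ℚ + (∑[ j < suc n ] c j * (negateˢ F ^S suc j) (suc n))
      ≡⟨ trans (cong (_+ (∑[ j < suc n ] c j * (negateˢ F ^S suc j) (suc n))) (*-zeroʳ (ℕ→ℚ (suc (suc n) C 1))))
               (+-identityˡ _) ⟩
    ∑[ j < suc n ] c j * (negateˢ F ^S suc j) (suc n)
      ≡⟨ ∑-cong (suc n) (λ j → cong (c j *_)
           (^S-shift {N} { - ℕ→ℚ (N !)} expTail-below (negateˢ-hyp1F1-1 N) (suc j) (suc n))) ⟩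
    ∑[ j < suc n ] c j * ((- ℕ→ℚ (N !)) ^ suc j * (expTail N ^S suc j) (suc n ℕ.+ N ℕ.* suc j)) ∎
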